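{- Let $K$ be a commutative semiring and $A$ a finite alphabet. For every closed $\mu$-expression $t\in\mathcal{T}_\mu$ over $K$, the power series $[\![t]\!]\in K\langle\langle A\rangle\rangle$ is context-free (constructively algebraic); in particular, for $K=\mathbb{B}$, $[\![t]\!]$ is a context-free language.
   Context: $K\langle\langle A\rangle\rangle$ is the set of functions $A^*\to K$, the final $K\times(-)^A$-coalgebra with $o(\sigma)=\sigma(\epsilon)$ and $\sigma_a(w)=\sigma(aw)$. For a finite set $X$, $K\langle X\rangle$ denotes the semiring of finitely supported functions $X^*\to K$ (noncommutative polynomials). Given $(o,\delta):X\to K\times K\langle X\rangle^A$ (write $x_a=\delta(x)(a)$), its extension to a $K\times(-)^A$-coalgebra on $K\langle X\rangle$ is: $\hat o(1)=1$, $1_a=0$; for $x\in X$, $w\in X^*$: $\hat o(xw)=o(x)\hat o(w)$, $(xw)_a=x_aw+o(x)w_a$; and linearly $\hat o(\sum k_iw_i)=\sum k_i\hat o(w_i)$, $(\sum k_iw_i)_a=\sum k_i(w_i)_a$. A power series is context-free (constructively algebraic) if it equals $[\![p]\!]$ for some finite $X$, some such $(o,\delta)$ and some $p\in K\langle X\rangle$, $[\![-]\!]$ being the final homomorphism from the extension. $\mu$-expressions over a countably infinite variable set $V$: $t::=\bar k\ (k\in K)\mid x\ (x\in V)\mid \bar a\ (a\in A)\mid t+t\mid t\times t\mid \mu x.g$, with guarded terms $g::=\bar a\times t\ (a\in A)\mid \bar k\ (k\in K)\mid g+g$ ($\mu x$ binds $x$). $\mathcal{T}_\mu$ is the set of closed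 $\mu$-expressions, a $K\times(-)^A$-coalgebra via: $o(\bar k)=k$, $\bar k_a=\bar 0$; $o(\bar b)=0$, $\bar b_a=\bar 1$ if $b=a$ else $\bar 0$; $o(u+v)=o(u)+o(v)$, $(u+v)_a=u_a+v_a$; $o(u\times v)=o(u)\cdot o(v)$, $(u\times v)_a=(u_a\times v)+(\overline{o(u)}\times v_a)$; $o(\mu x.u)=o(u[\mu x.u/x])$, $(\mu x.u)_a=(u[\mu x.u/x])_a$, where $u[\mu x.u/x]$ substitutes $\mu x.u$ for the free occurrences of $x$. $[\![-]\!]:\mathcal{T}_\mu\to K\langle\langle A\rangle\rangle$ is the final homomorphism.
   Formalization: In the coalgebra on $\mathcal{T}_\mu$, $o(\mu x.g)$ takes $o(\bar a\times t[\mu x.g/x])$ as 0 rather than $0\cdot o(t[\mu x.g/x])$, and $(\mu x.g)_a$ omits the summand $\bar 0\times(t[\mu x.g/x])_a$ from each $(\bar a\times t[\mu x.g/x])_a$. Apart from conventions, each condition added here is assumed in the paper as well or is needed for the statement above to hold. -}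

module Defs where

open import Level using (_⊔_)
open import Algebra.Bundles using (CommutativeSemiring)
open import Data.Nat as ℕ using (ℕ)
open import Data.Fin using (Fin; _≟_)
open import Data.List using (List; []; _∷_; _++_; map; foldr; concatMap)
open import Data.List.Membership.Propositional using (_∈_)
open import Data.Product using (Σ; Σ-syntax; _×_; _,_)
open import Relation.Nullary using (yes; no)

module Semantics {c ℓ} (K : CommutativeSemiring c ℓ) (m : ℕ) where

  open CommutativeSemiring K using (_≈_; _+_; _*_; 0#; 1#) renaming (Carrier to 𝕂)

  A : Set
  A = Fin m

  Series : Set c
  Series = List A → 𝕂

  _≈ₛ_ : Series → Series → Set ℓ
  σ ≈ₛ τ = ∀ w → σ w ≈ τ w

  Var : Set
  Var = ℕ

  mutual
    data Term : Set c where
      con  : 𝕂 → Term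
      var  : Var → Term
      sym  : A → Term
      _⊕_  : Term → Term → Term
      _⊗_  : Term → Term → Term
      μ    : Var → Guarded → Term

    data Guarded : Set c where
      _∙_  : A → Term → Guarded
      gcon : 𝕂 → Guarded
      _⊞_  : Guarded → Guarded → Guarded

  embed : Guarded → Term
  embed (a ∙ t)  = sym a ⊗ t
  embed (gcon k) = con k
  embed (g ⊞ h)  = embed g ⊕ embed h

  mutual
    _[_/_] : Term → Term → Var → Term
    con k   [ s / x ] = con k
    var y   [ s / x ] with x ℕ.≟ y
    ... | yes _ = s
    ... | no  _ = var y
    sym a   [ s / x ] = sym a
    (u ⊕ v) [ s / x ] = (u [ s / x ]) ⊕ (v [ s / x ])
    (u ⊗ v) [ s / x ] = (u [ s / x ]) ⊗ (v [ s / x ])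
    μ y g   [ s / x ] with x ℕ.≟ y
    ... | yes _ = μ y g
    ... | no  _ = μ y (g [ s / x ]g)

    _[_/_]g : Guarded → Term → Var → Guarded
    (a ∙ t) [ s / x ]g = a ∙ (t [ s / x ])
    gcon k  [ s / x ]g = gcon k
    (g ⊞ h) [ s / x ]g = (g [ s / x ]g) ⊞ (h [ s / x ]g)

  mutual
    data ClosedIn (Γ : List Var) : Term → Set c where
      con : ∀ k → ClosedIn Γ (con k)
      var : ∀ {x} → x ∈ Γ → ClosedIn Γ (var x)
      sym : ∀ a → ClosedIn Γ (sym a)
      _⊕_ : ∀ {u v} → ClosedIn Γ u → ClosedIn Γ v → ClosedIn Γ (u ⊕ v)
      _⊗_ : ∀ {u v} → ClosedIn Γ u → ClosedIn Γ v → ClosedIn Γ (u ⊗ v)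
      μ   : ∀ {x g} → ClosedInG (x ∷ Γ) g → ClosedIn Γ (μ x g)

    data ClosedInG (Γ : List Var) : Guarded → Set c where
      _∙_  : ∀ a {t} → ClosedIn Γ t → ClosedInG Γ (a ∙ t)
      gcon : ∀ k → ClosedInG Γ (gcon k)
      _⊞_  : ∀ {g h} → ClosedInG Γ g → ClosedInG Γ h → ClosedInG Γ (g ⊞ h)

  Closed : Term → Set c
  Closed = ClosedIn []

  -- The K × (-)^A coalgebra structure on μ-expressions.
  -- (Defined on all terms; free variables get the junk value 0 / 0̄,
  -- which is never reached from a closed term.)
  -- output of a guarded term: o(ā × t) = o(ā)·o(t) = 0·o(t) = 0
  oG : Guarded → 𝕂
  oG (a ∙ t)  = 0#
  oG (gcon k) = k
  oG (g ⊞ h)  = oG g + oG h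

  o : Term → 𝕂
  o (con k) = k
  o (var x) = 0#
  o (sym a) = 0#
  o (u ⊕ v) = o u + o v
  o (u ⊗ v) = o u * o v
  o (μ x g) = oG g          -- = o(g[μx.g/x])

  δsym : A → A → Term
  δsym b a with b ≟ a
  ... | yes _ = con 1#
  ... | no  _ = con 0#

  -- derivative of g[s/x] for a guarded g; the summand 0̄ × (t[s/x])_a of
  -- (ā' × t[s/x])_a, which denotes 0, is omitted
  δG : Guarded → Term → Var → A → Term
  δG (b ∙ t)  s x a = δsym b a ⊗ (t [ s / x ])
  δG (gcon k) s x a = con 0#
  δG (g ⊞ h)  s x a = δG g s x a ⊕ δG h s x a

  δ : Term → A → Term
  δ (con k) a = con 0#
  δ (var x) a = con 0#
  δ (sym b) a = δsym b a
  δ (u ⊕ v) a = δ u a ⊕ δ v a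
  δ (u ⊗ v) a = (δ u a ⊗ v) ⊕ (con (o u) ⊗ δ v a)
  δ (μ x g) a = δG g (μ x g) x a     -- = (g[μx.g/x])_a

  ⟦_⟧ : Term → Series
  ⟦ t ⟧ []      = o t
  ⟦ t ⟧ (a ∷ w) = ⟦ δ t a ⟧ w

  Poly : ℕ → Set c
  Poly n = List (𝕂 × List (Fin n))

  record System (n : ℕ) : Set c where
    field
      out : Fin n → 𝕂
      der : Fin n → A → Poly n

  module Extension {n : ℕ} (S : System n) where
    open System S

    _·ʳ_ : Poly n → List (Fin n) → Poly n
    p ·ʳ w = map (λ { (k , v) → (k , v ++ w) }) p

    _·ˢ_ : 𝕂 → Poly n → Poly n
    k ·ˢ p = map (λ { (k′ , v) → (k * k′ , v) }) p

    ôw : List (Fin n) → 𝕂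
    ôw []      = 1#
    ôw (x ∷ w) = out x * ôw w

    δw : List (Fin n) → A → Poly n
    δw []      a = []
    δw (x ∷ w) a = (der x a ·ʳ w) ++ (out x ·ˢ δw w a)

    ô : Poly n → 𝕂
    ô p = foldr (λ { (k , w) r → k * ôw w + r }) 0# p

    δp : Poly n → A → Poly n
    δp p a = concatMap (λ { (k , w) → k ·ˢ δw w a }) p

    ⟦_⟧ₚ : Poly n → Series
    ⟦ p ⟧ₚ []      = ô p
    ⟦ p ⟧ₚ (a ∷ w) = ⟦ δp p a ⟧ₚ w

  ContextFree : Series → Set (c ⊔ ℓ)
  ContextFree σ =
    Σ[ n ∈ ℕ ] Σ[ S ∈ System n ] Σ[ p ∈ Poly n ] (Extension.⟦_⟧ₚ S p ≈ₛ σ)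

-- Give every letter and every μ-occurrence of t a variable of a polynomial
-- system; the variable of μy.g stands for the closed term obtained by
-- substituting the enclosing binders.  A subterm in the scope of binders
-- translates to a polynomial: letters and μ's become their variables, bound
-- variables the variable of their binder, + and × become sum and product.
-- By guardedness the a-derivative of μy.g is the sum of the translations of
-- the bodies guarded by ā, so the semantics of the occurrences is a
-- solution of the system.  A polynomial evaluated at a solution equals its
-- image under the final homomorphism, and ⟦ t ⟧ is the value of the
-- translation of t.

module Submission where

open import Level using (_⊔_)
open import Algebra.Bundles using (CommutativeSemiring)
import Algebra.Properties.CommutativeSemigroup as CommutativeSemigroupProperties
import Algebra.Solver.Ring.NaturalCoefficients.Default as Solver
open import Data.Nat as ℕ using (ℕ)
open import Data.Fin as Fin using (Fin; zero; suc; _↑ˡ_; _↑ʳ_; splitAt)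
open import Data.Fin.Properties using (splitAt-↑ˡ; splitAt-↑ʳ)
open import Data.List using (List; []; _∷_; _++_; map)
open import Data.List.Properties using (map-++)
open import Data.List.Membership.Propositional using (_∈_; _∉_)
open import Data.List.Relation.Unary.Any using (here; there)
open import Data.List.Relation.Unary.All using (All; []; _∷_)
import Data.List.Relation.Unary.All.Properties as All
open import Data.List.Relation.Binary.Subset.Propositional using (_⊆_)
open import Data.List.Relation.Binary.Subset.Propositional.Properties
  using (∷⁺ʳ; ∈-∷⁺ʳ; xs⊆xs++ys; xs⊆ys++xs)
open import Data.Product using (_×_; _,_; proj₁; proj₂)
open import Data.Sum as Sum using (_⊎_; inj₁; inj₂; [_,_]; [_,_]′)
open import Data.Empty using (⊥-elim)
open import Function using (_∘_)
open import Relation.Nullary using (yes; no)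
open import Relation.Binary.Bundles using (Setoid)
open import Relation.Binary.PropositionalEquality as ≡ using (_≡_)
import Relation.Binary.Reasoning.Setoid as SetoidReasoning

open import Defs

module FormalSeries {c ℓ} (K : CommutativeSemiring c ℓ) (A : Set) where
  open CommutativeSemiring K renaming (Carrier to 𝕂)
  open CommutativeSemigroupProperties +-commutativeSemigroup
    using () renaming (interchange to +-interchange)
  open SetoidReasoning setoid
  open Solver K using (solve; _:=_; _:+_; _:*_)

  Series : Set c
  Series = List A → 𝕂

  infix 4 _≈ₛ_
  _≈ₛ_ : Series → Series → Set ℓ
  σ ≈ₛ τ = ∀ w → σ w ≈ τ w

  seriesSetoid : Setoid c ℓ
  seriesSetoid = record
    { Carrier       = Series
    ; _≈_           = _≈ₛ_
    ; isEquivalence = record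
      { refl  = λ _ → refl
      ; sym   = λ e w → sym (e w)
      ; trans = λ e f w → trans (e w) (f w)
      }
    }

  open Setoid seriesSetoid public
    using () renaming (refl to ≈ₛ-refl; sym to ≈ₛ-sym; reflexive to ≈ₛ-reflexive)

  ∂ : A → Series → Series
  ∂ a σ w = σ (a ∷ w)

  0ₛ : Series
  0ₛ _ = 0#

  1ₛ : Series
  1ₛ []      = 1#
  1ₛ (_ ∷ _) = 0#

  infixl 6 _+ₛ_
  infixl 7 _*ₛ_
  infixr 8 _•_

  _+ₛ_ : Series → Series → Series
  (σ +ₛ τ) w = σ w + τ w

  _•_ : 𝕂 → Series → Series
  (k • σ) w = k * σ w

  -- The Cauchy product, defined by the product rule (σ τ)_a = σ_a τ + σ(ε) τ_a.
  _*ₛ_ : Series → Series → Series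
  (σ *ₛ τ) []      = σ [] * τ []
  (σ *ₛ τ) (a ∷ w) = (∂ a σ *ₛ τ) w + σ [] * τ (a ∷ w)

  +ₛ-cong : ∀ {σ σ′ τ τ′} → σ ≈ₛ σ′ → τ ≈ₛ τ′ → σ +ₛ τ ≈ₛ σ′ +ₛ τ′
  +ₛ-cong e f w = +-cong (e w) (f w)

  +ₛ-congˡ : ∀ {σ τ τ′} → τ ≈ₛ τ′ → σ +ₛ τ ≈ₛ σ +ₛ τ′
  +ₛ-congˡ = +ₛ-cong ≈ₛ-refl

  +ₛ-congʳ : ∀ {σ σ′ τ} → σ ≈ₛ σ′ → σ +ₛ τ ≈ₛ σ′ +ₛ τ
  +ₛ-congʳ e = +ₛ-cong e ≈ₛ-refl

  +ₛ-assoc : ∀ σ τ υ → (σ +ₛ τ) +ₛ υ ≈ₛ σ +ₛ (τ +ₛ υ)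
  +ₛ-assoc σ τ υ w = +-assoc (σ w) (τ w) (υ w)

  +ₛ-identityˡ : ∀ σ → 0ₛ +ₛ σ ≈ₛ σ
  +ₛ-identityˡ σ w = +-identityˡ (σ w)

  +ₛ-identityʳ : ∀ σ → σ +ₛ 0ₛ ≈ₛ σ
  +ₛ-identityʳ σ w = +-identityʳ (σ w)

  •-cong : ∀ {k k′ σ σ′} → k ≈ k′ → σ ≈ₛ σ′ → k • σ ≈ₛ k′ • σ′
  •-cong e f w = *-cong e (f w)

  •-congˡ : ∀ {k σ σ′} → σ ≈ₛ σ′ → k • σ ≈ₛ k • σ′
  •-congˡ = •-cong refl

  •-identityˡ : ∀ σ → 1# • σ ≈ₛ σ
  •-identityˡ σ w = *-identityˡ (σ w)

  •-assoc : ∀ k k′ σ → (k * k′) • σ ≈ₛ k • k′ • σ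
  •-assoc k k′ σ w = *-assoc k k′ (σ w)

  •-distribˡ : ∀ k σ τ → k • (σ +ₛ τ) ≈ₛ k • σ +ₛ k • τ
  •-distribˡ k σ τ w = distribˡ k (σ w) (τ w)

  •-zeroʳ : ∀ k → k • 0ₛ ≈ₛ 0ₛ
  •-zeroʳ k w = zeroʳ k

  *ₛ-cong : ∀ {σ σ′ τ τ′} → σ ≈ₛ σ′ → τ ≈ₛ τ′ → σ *ₛ τ ≈ₛ σ′ *ₛ τ′
  *ₛ-cong e f []      = *-cong (e []) (f [])
  *ₛ-cong e f (a ∷ w) = +-cong (*ₛ-cong (e ∘ (a ∷_)) f w) (*-cong (e []) (f (a ∷ w)))

  *ₛ-zeroˡ : ∀ τ → 0ₛ *ₛ τ ≈ₛ 0ₛ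
  *ₛ-zeroˡ τ []      = zeroˡ (τ [])
  *ₛ-zeroˡ τ (a ∷ w) = trans (+-cong (*ₛ-zeroˡ τ w) (zeroˡ _)) (+-identityˡ 0#)

  *ₛ-zeroʳ : ∀ σ → σ *ₛ 0ₛ ≈ₛ 0ₛ
  *ₛ-zeroʳ σ []      = zeroʳ (σ [])
  *ₛ-zeroʳ σ (a ∷ w) = trans (+-cong (*ₛ-zeroʳ (∂ a σ) w) (zeroʳ _)) (+-identityˡ 0#)

  *ₛ-identityˡ : ∀ τ → 1ₛ *ₛ τ ≈ₛ τ
  *ₛ-identityˡ τ []      = *-identityˡ (τ [])
  *ₛ-identityˡ τ (a ∷ w) = trans (+-cong (*ₛ-zeroˡ τ w) (*-identityˡ _)) (+-identityˡ _)

  *ₛ-identityʳ : ∀ σ → σ *ₛ 1ₛ ≈ₛ σ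
  *ₛ-identityʳ σ []      = *-identityʳ (σ [])
  *ₛ-identityʳ σ (a ∷ w) = trans (+-cong (*ₛ-identityʳ (∂ a σ) w) (zeroʳ _)) (+-identityʳ _)

  *ₛ-distribʳ : ∀ σ σ′ τ → (σ +ₛ σ′) *ₛ τ ≈ₛ σ *ₛ τ +ₛ σ′ *ₛ τ
  *ₛ-distribʳ σ σ′ τ []      = distribʳ (τ []) (σ []) (σ′ [])
  *ₛ-distribʳ σ σ′ τ (a ∷ w) = begin
    ((∂ a σ +ₛ ∂ a σ′) *ₛ τ) w + (σ [] + σ′ []) * τ (a ∷ w)
      ≈⟨ +-cong (*ₛ-distribʳ (∂ a σ) (∂ a σ′) τ w) (distribʳ _ _ _) ⟩
    ((∂ a σ *ₛ τ) w + (∂ a σ′ *ₛ τ) w) + (σ [] * τ (a ∷ w) + σ′ [] * τ (a ∷ w))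
      ≈⟨ +-interchange _ _ _ _ ⟩
    (σ *ₛ τ) (a ∷ w) + (σ′ *ₛ τ) (a ∷ w)
      ∎

  *ₛ-distribˡ : ∀ σ τ τ′ → σ *ₛ (τ +ₛ τ′) ≈ₛ σ *ₛ τ +ₛ σ *ₛ τ′
  *ₛ-distribˡ σ τ τ′ []      = distribˡ (σ []) (τ []) (τ′ [])
  *ₛ-distribˡ σ τ τ′ (a ∷ w) = begin
    (∂ a σ *ₛ (τ +ₛ τ′)) w + σ [] * (τ (a ∷ w) + τ′ (a ∷ w))
      ≈⟨ +-cong (*ₛ-distribˡ (∂ a σ) τ τ′ w) (distribˡ _ _ _) ⟩
    ((∂ a σ *ₛ τ) w + (∂ a σ *ₛ τ′) w) + (σ [] * τ (a ∷ w) + σ [] * τ′ (a ∷ w))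
      ≈⟨ +-interchange _ _ _ _ ⟩
    (σ *ₛ τ) (a ∷ w) + (σ *ₛ τ′) (a ∷ w)
      ∎

  •-*ₛ-assocˡ : ∀ k σ τ → (k • σ) *ₛ τ ≈ₛ k • (σ *ₛ τ)
  •-*ₛ-assocˡ k σ τ []      = *-assoc k (σ []) (τ [])
  •-*ₛ-assocˡ k σ τ (a ∷ w) = begin
    ((k • ∂ a σ) *ₛ τ) w + k * σ [] * τ (a ∷ w)
      ≈⟨ +-cong (•-*ₛ-assocˡ k (∂ a σ) τ w) (*-assoc _ _ _) ⟩
    k * (∂ a σ *ₛ τ) w + k * (σ [] * τ (a ∷ w))
      ≈⟨ distribˡ _ _ _ ⟨
    k * (σ *ₛ τ) (a ∷ w)
      ∎

  •-*ₛ-assocʳ : ∀ k σ τ → σ *ₛ (k • τ) ≈ₛ k • (σ *ₛ τ)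
  •-*ₛ-assocʳ k σ τ []      =
    solve 3 (λ k x y → x :* (k :* y) := k :* (x :* y)) refl k (σ []) (τ [])
  •-*ₛ-assocʳ k σ τ (a ∷ w) = begin
    (∂ a σ *ₛ (k • τ)) w + σ [] * (k * τ (a ∷ w))
      ≈⟨ +-congʳ (•-*ₛ-assocʳ k (∂ a σ) τ w) ⟩
    k * (∂ a σ *ₛ τ) w + σ [] * (k * τ (a ∷ w))
      ≈⟨ solve 4 (λ k x y z → k :* x :+ y :* (k :* z) := k :* (x :+ y :* z)) refl k _ _ _ ⟩
    k * (σ *ₛ τ) (a ∷ w)
      ∎

  *ₛ-assoc : ∀ σ τ υ → (σ *ₛ τ) *ₛ υ ≈ₛ σ *ₛ (τ *ₛ υ)
  *ₛ-assoc σ τ υ []      = *-assoc (σ []) (τ []) (υ [])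
  *ₛ-assoc σ τ υ (a ∷ w) = begin
    ((∂ a σ *ₛ τ +ₛ σ [] • ∂ a τ) *ₛ υ) w + σ [] * τ [] * υ (a ∷ w)
      ≈⟨ +-congʳ (*ₛ-distribʳ (∂ a σ *ₛ τ) (σ [] • ∂ a τ) υ w) ⟩
    (((∂ a σ *ₛ τ) *ₛ υ) w + ((σ [] • ∂ a τ) *ₛ υ) w) + σ [] * τ [] * υ (a ∷ w)
      ≈⟨ +-congʳ (+-cong (*ₛ-assoc (∂ a σ) τ υ w) (•-*ₛ-assocˡ (σ []) (∂ a τ) υ w)) ⟩
    ((∂ a σ *ₛ (τ *ₛ υ)) w + σ [] * (∂ a τ *ₛ υ) w) + σ [] * τ [] * υ (a ∷ w)
      ≈⟨ solve 5 (λ x s y t u → (x :+ s :* y) :+ s :* t :* u := x :+ s :* (y :+ t :* u))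
                 refl _ _ _ _ _ ⟩
    (σ *ₛ (τ *ₛ υ)) (a ∷ w)
      ∎

module Polynomials {c ℓ} (K : CommutativeSemiring c ℓ) (X : Set) where
  open CommutativeSemiring K using (_*_) renaming (Carrier to 𝕂)

  Monomial : Set
  Monomial = List X

  -- The formal sums Σ kᵢ wᵢ of Semantics.Poly; _·ˢ_ and _·ʳ_ are definitionally
  -- those of Semantics.Extension.
  Polynomial : Set c
  Polynomial = List (𝕂 × Monomial)

  _·ˢ_ : 𝕂 → Polynomial → Polynomial
  k ·ˢ p = map (λ { (k′ , v) → (k * k′ , v) }) p

  _·ʳ_ : Polynomial → Monomial → Polynomial
  p ·ʳ w = map (λ { (k , v) → (k , v ++ w) }) p

  _·ˡ_ : Monomial → Polynomial → Polynomial
  w ·ˡ p = map (λ { (k , v) → (k , w ++ v) }) p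

  _*ₚ_ : Polynomial → Polynomial → Polynomial
  []            *ₚ q = []
  ((k , w) ∷ p) *ₚ q = k ·ˢ (w ·ˡ q) ++ p *ₚ q

module Evaluation {c ℓ} (K : CommutativeSemiring c ℓ) {A X : Set}
                  (σ : X → FormalSeries.Series K A) where
  open CommutativeSemiring K using (_*_; 1#)
  open FormalSeries K A
  open Polynomials K X
  open SetoidReasoning seriesSetoid

  evalₘ : Monomial → Series
  evalₘ []      = 1ₛ
  evalₘ (x ∷ w) = σ x *ₛ evalₘ w

  eval : Polynomial → Series
  eval []            = 0ₛ
  eval ((k , w) ∷ p) = k • evalₘ w +ₛ eval p

  eval-constant : ∀ k → eval ((k , []) ∷ []) ≈ₛ k • 1ₛ
  eval-constant k = +ₛ-identityʳ (k • 1ₛ)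

  eval-variable : ∀ x → eval ((1# , x ∷ []) ∷ []) ≈ₛ σ x
  eval-variable x = begin
    1# • (σ x *ₛ 1ₛ) +ₛ 0ₛ ≈⟨ +ₛ-identityʳ _ ⟩
    1# • (σ x *ₛ 1ₛ)       ≈⟨ •-identityˡ _ ⟩
    σ x *ₛ 1ₛ              ≈⟨ *ₛ-identityʳ (σ x) ⟩
    σ x                    ∎

  evalₘ-++ : ∀ v w → evalₘ (v ++ w) ≈ₛ evalₘ v *ₛ evalₘ w
  evalₘ-++ []      w = ≈ₛ-sym (*ₛ-identityˡ (evalₘ w))
  evalₘ-++ (x ∷ v) w = begin
    σ x *ₛ evalₘ (v ++ w)       ≈⟨ *ₛ-cong ≈ₛ-refl (evalₘ-++ v w) ⟩
    σ x *ₛ (evalₘ v *ₛ evalₘ w) ≈⟨ *ₛ-assoc (σ x) (evalₘ v) (evalₘ w) ⟨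
    evalₘ (x ∷ v) *ₛ evalₘ w    ∎

  eval-++ : ∀ p q → eval (p ++ q) ≈ₛ eval p +ₛ eval q
  eval-++ []            q = ≈ₛ-sym (+ₛ-identityˡ (eval q))
  eval-++ ((k , v) ∷ p) q = begin
    k • evalₘ v +ₛ eval (p ++ q)           ≈⟨ +ₛ-congˡ (eval-++ p q) ⟩
    k • evalₘ v +ₛ (eval p +ₛ eval q)      ≈⟨ +ₛ-assoc _ _ _ ⟨
    (k • evalₘ v +ₛ eval p) +ₛ eval q      ∎

  eval-·ˢ : ∀ k p → eval (k ·ˢ p) ≈ₛ k • eval p
  eval-·ˢ k []             = ≈ₛ-sym (•-zeroʳ k)
  eval-·ˢ k ((k′ , v) ∷ p) = begin
    (k * k′) • evalₘ v +ₛ eval (k ·ˢ p)    ≈⟨ +ₛ-cong (•-assoc k k′ _) (eval-·ˢ k p) ⟩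
    k • k′ • evalₘ v +ₛ k • eval p         ≈⟨ •-distribˡ k _ _ ⟨
    k • (k′ • evalₘ v +ₛ eval p)           ∎

  eval-·ʳ : ∀ p w → eval (p ·ʳ w) ≈ₛ eval p *ₛ evalₘ w
  eval-·ʳ []            w = ≈ₛ-sym (*ₛ-zeroˡ (evalₘ w))
  eval-·ʳ ((k , v) ∷ p) w = begin
    k • evalₘ (v ++ w) +ₛ eval (p ·ʳ w)
      ≈⟨ +ₛ-cong (•-congˡ (evalₘ-++ v w)) (eval-·ʳ p w) ⟩
    k • (evalₘ v *ₛ evalₘ w) +ₛ eval p *ₛ evalₘ w
      ≈⟨ +ₛ-congʳ (•-*ₛ-assocˡ k (evalₘ v) (evalₘ w)) ⟨
    (k • evalₘ v) *ₛ evalₘ w +ₛ eval p *ₛ evalₘ w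
      ≈⟨ *ₛ-distribʳ (k • evalₘ v) (eval p) (evalₘ w) ⟨
    (k • evalₘ v +ₛ eval p) *ₛ evalₘ w
      ∎

  eval-·ˡ : ∀ w p → eval (w ·ˡ p) ≈ₛ evalₘ w *ₛ eval p
  eval-·ˡ w []            = ≈ₛ-sym (*ₛ-zeroʳ (evalₘ w))
  eval-·ˡ w ((k , v) ∷ p) = begin
    k • evalₘ (w ++ v) +ₛ eval (w ·ˡ p)
      ≈⟨ +ₛ-cong (•-congˡ (evalₘ-++ w v)) (eval-·ˡ w p) ⟩
    k • (evalₘ w *ₛ evalₘ v) +ₛ evalₘ w *ₛ eval p
      ≈⟨ +ₛ-congʳ (•-*ₛ-assocʳ k (evalₘ w) (evalₘ v)) ⟨
    evalₘ w *ₛ (k • evalₘ v) +ₛ evalₘ w *ₛ eval p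
      ≈⟨ *ₛ-distribˡ (evalₘ w) (k • evalₘ v) (eval p) ⟨
    evalₘ w *ₛ (k • evalₘ v +ₛ eval p)
      ∎

  eval-*ₚ : ∀ p q → eval (p *ₚ q) ≈ₛ eval p *ₛ eval q
  eval-*ₚ []            q = ≈ₛ-sym (*ₛ-zeroˡ (eval q))
  eval-*ₚ ((k , w) ∷ p) q = begin
    eval (k ·ˢ (w ·ˡ q) ++ p *ₚ q)
      ≈⟨ eval-++ (k ·ˢ (w ·ˡ q)) (p *ₚ q) ⟩
    eval (k ·ˢ (w ·ˡ q)) +ₛ eval (p *ₚ q)
      ≈⟨ +ₛ-cong (eval-·ˢ k (w ·ˡ q)) (eval-*ₚ p q) ⟩
    k • eval (w ·ˡ q) +ₛ eval p *ₛ eval q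
      ≈⟨ +ₛ-congʳ (•-congˡ (eval-·ˡ w q)) ⟩
    k • (evalₘ w *ₛ eval q) +ₛ eval p *ₛ eval q
      ≈⟨ +ₛ-congʳ (•-*ₛ-assocˡ k (evalₘ w) (eval q)) ⟨
    (k • evalₘ w) *ₛ eval q +ₛ eval p *ₛ eval q
      ≈⟨ *ₛ-distribʳ (k • evalₘ w) (eval p) (eval q) ⟨
    (k • evalₘ w +ₛ eval p) *ₛ eval q
      ∎

module Solutions {c ℓ} (K : CommutativeSemiring c ℓ) (m : ℕ) where
  open CommutativeSemiring K using (_≈_; refl; sym; trans; +-cong; *-cong; *-congˡ)
  open Semantics K m using (A; System; module Extension)
  open FormalSeries K A
  record IsSolution {n} (S : System n) (σ : Fin n → Series) : Set (c ⊔ ℓ) where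
    open System S
    field
      output     : ∀ x → σ x [] ≈ out x
      derivative : ∀ x a → ∂ a (σ x) ≈ₛ Evaluation.eval K σ (der x a)

  module _ {n} {S : System n} {σ : Fin n → Series} (solution : IsSolution S σ) where
    open System S
    open Extension S
    open Evaluation K σ
    open IsSolution solution
    open SetoidReasoning seriesSetoid

    evalₘ-output : ∀ w → evalₘ w [] ≈ ôw w
    evalₘ-output []      = refl
    evalₘ-output (x ∷ w) = *-cong (output x) (evalₘ-output w)

    eval-output : ∀ p → eval p [] ≈ ô p
    eval-output []            = refl
    eval-output ((k , w) ∷ p) = +-cong (*-congˡ (evalₘ-output w)) (eval-output p)

    evalₘ-derivative : ∀ w a → ∂ a (evalₘ w) ≈ₛ eval (δw w a)
    evalₘ-derivative []      a = ≈ₛ-refl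
    evalₘ-derivative (x ∷ w) a = begin
      ∂ a (σ x) *ₛ evalₘ w +ₛ σ x [] • ∂ a (evalₘ w)
        ≈⟨ +ₛ-cong (*ₛ-cong (derivative x a) ≈ₛ-refl) (•-cong (output x) (evalₘ-derivative w a)) ⟩
      eval (der x a) *ₛ evalₘ w +ₛ out x • eval (δw w a)
        ≈⟨ +ₛ-cong (eval-·ʳ (der x a) w) (eval-·ˢ (out x) (δw w a)) ⟨
      eval (der x a ·ʳ w) +ₛ eval (out x ·ˢ δw w a)
        ≈⟨ eval-++ (der x a ·ʳ w) (out x ·ˢ δw w a) ⟨
      eval (δw (x ∷ w) a)
        ∎

    eval-derivative : ∀ p a → ∂ a (eval p) ≈ₛ eval (δp p a)
    eval-derivative []            a = ≈ₛ-refl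
    eval-derivative ((k , w) ∷ p) a = begin
      k • ∂ a (evalₘ w) +ₛ ∂ a (eval p)
        ≈⟨ +ₛ-cong (•-congˡ (evalₘ-derivative w a)) (eval-derivative p a) ⟩
      k • eval (δw w a) +ₛ eval (δp p a)
        ≈⟨ +ₛ-congʳ (eval-·ˢ k (δw w a)) ⟨
      eval (k ·ˢ δw w a) +ₛ eval (δp p a)
        ≈⟨ eval-++ (k ·ˢ δw w a) (δp p a) ⟨
      eval (δp ((k , w) ∷ p) a)
        ∎

    ⟦⟧ₚ≈eval : ∀ p → ⟦ p ⟧ₚ ≈ₛ eval p
    ⟦⟧ₚ≈eval p []      = sym (eval-output p)
    ⟦⟧ₚ≈eval p (a ∷ w) = trans (⟦⟧ₚ≈eval (δp p a) w) (sym (eval-derivative p a w))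

module MuExpressions {c ℓ} (K : CommutativeSemiring c ℓ) (m : ℕ) where
  open CommutativeSemiring K
    using (0#; 1#; refl; trans; +-cong; +-congʳ; +-identityˡ; zeroˡ; zeroʳ; *-identityʳ)
    renaming (Carrier to 𝕂; sym to ≈-sym)
  open Semantics K m hiding (Series; _≈ₛ_)
  open FormalSeries K A

  ⟦con⟧ : ∀ k → ⟦ con k ⟧ ≈ₛ k • 1ₛ
  ⟦con⟧ k []      = ≈-sym (*-identityʳ k)
  ⟦con⟧ k (a ∷ w) = trans (⟦con⟧ 0# w) (trans (zeroˡ _) (≈-sym (zeroʳ k)))

  ⟦0⟧ : ⟦ con 0# ⟧ ≈ₛ 0ₛ
  ⟦0⟧ w = trans (⟦con⟧ 0# w) (zeroˡ _)

  ⟦var⟧ : ∀ x → ⟦ var x ⟧ ≈ₛ 0ₛ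
  ⟦var⟧ x []      = refl
  ⟦var⟧ x (a ∷ w) = ⟦0⟧ w

  ⟦⊕⟧ : ∀ u v → ⟦ u ⊕ v ⟧ ≈ₛ ⟦ u ⟧ +ₛ ⟦ v ⟧
  ⟦⊕⟧ u v []      = refl
  ⟦⊕⟧ u v (a ∷ w) = ⟦⊕⟧ (δ u a) (δ v a) w

  ⟦con⊗⟧ : ∀ k s → ⟦ con k ⊗ s ⟧ ≈ₛ k • ⟦ s ⟧
  ⟦con⊗⟧ k s []      = refl
  ⟦con⊗⟧ k s (a ∷ w) = begin
    ⟦ (con 0# ⊗ s) ⊕ (con k ⊗ δ s a) ⟧ w  ≈⟨ ⟦⊕⟧ (con 0# ⊗ s) (con k ⊗ δ s a) w ⟩
    ⟦ con 0# ⊗ s ⟧ w + ⟦ con k ⊗ δ s a ⟧ w  ≈⟨ +-cong (⟦con⊗⟧ 0# s w) (⟦con⊗⟧ k (δ s a) w) ⟩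
    0# * ⟦ s ⟧ w + k * ⟦ δ s a ⟧ w          ≈⟨ +-congʳ (zeroˡ _) ⟩
    0# + k * ⟦ δ s a ⟧ w                    ≈⟨ +-identityˡ _ ⟩
    k * ⟦ s ⟧ (a ∷ w)                       ∎
    where open SetoidReasoning (CommutativeSemiring.setoid K)
          open CommutativeSemiring K using (_+_; _*_)

  ⟦⊗⟧ : ∀ u v → ⟦ u ⊗ v ⟧ ≈ₛ ⟦ u ⟧ *ₛ ⟦ v ⟧
  ⟦⊗⟧ u v []      = refl
  ⟦⊗⟧ u v (a ∷ w) = trans (⟦⊕⟧ (δ u a ⊗ v) (con (o u) ⊗ δ v a) w)
                          (+-cong (⟦⊗⟧ (δ u a) v w) (⟦con⊗⟧ (o u) (δ v a) w))

  kronecker : A → A → 𝕂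
  kronecker b a with b Fin.≟ a
  ... | yes _ = 1#
  ... | no  _ = 0#

  δsym≡con-kronecker : ∀ b a → δsym b a ≡ con (kronecker b a)
  δsym≡con-kronecker b a with b Fin.≟ a
  ... | yes _ = ≡.refl
  ... | no  _ = ≡.refl

  mutual
    ClosedIn-mono : ∀ {Γ Δ u} → Γ ⊆ Δ → ClosedIn Γ u → ClosedIn Δ u
    ClosedIn-mono h (con k)      = con k
    ClosedIn-mono h (var i)      = var (h i)
    ClosedIn-mono h (sym a)      = sym a
    ClosedIn-mono h (cu ⊕ cv)    = ClosedIn-mono h cu ⊕ ClosedIn-mono h cv
    ClosedIn-mono h (cu ⊗ cv)    = ClosedIn-mono h cu ⊗ ClosedIn-mono h cv
    ClosedIn-mono h (μ {x} cg)   = μ (ClosedInG-mono (∷⁺ʳ x h) cg)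

    ClosedInG-mono : ∀ {Γ Δ g} → Γ ⊆ Δ → ClosedInG Γ g → ClosedInG Δ g
    ClosedInG-mono h (a ∙ cu)   = a ∙ ClosedIn-mono h cu
    ClosedInG-mono h (gcon k)   = gcon k
    ClosedInG-mono h (cg ⊞ ch)  = ClosedInG-mono h cg ⊞ ClosedInG-mono h ch

  mutual
    ClosedIn-[/] : ∀ {Γ Δ u s x} → ClosedIn Γ u → Closed s → Γ ⊆ x ∷ Δ →
                   ClosedIn Δ (u [ s / x ])
    ClosedIn-[/] (con k) cs h = con k
    ClosedIn-[/] {x = x} (var {y} i) cs h with x ℕ.≟ y
    ... | yes _ = ClosedIn-mono (λ ()) cs
    ... | no x≢y with h i
    ...   | here y≡x = ⊥-elim (x≢y (≡.sym y≡x))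
    ...   | there j  = var j
    ClosedIn-[/] (sym a)   cs h = sym a
    ClosedIn-[/] (cu ⊕ cv) cs h = ClosedIn-[/] cu cs h ⊕ ClosedIn-[/] cv cs h
    ClosedIn-[/] (cu ⊗ cv) cs h = ClosedIn-[/] cu cs h ⊗ ClosedIn-[/] cv cs h
    ClosedIn-[/] {x = x} (μ {y} cg) cs h with x ℕ.≟ y
    ... | yes ≡.refl = μ (ClosedInG-mono (∈-∷⁺ʳ (here ≡.refl) h) cg)
    ... | no _       = μ (ClosedInG-[/] cg cs h′)
      where
        h′ : y ∷ _ ⊆ x ∷ y ∷ _
        h′ (here z≡y)  = there (here z≡y)
        h′ (there i) with h i
        ... | here z≡x = here z≡x
        ... | there j  = there (there j)

    ClosedInG-[/] : ∀ {Γ Δ g s x} → ClosedInG Γ g → Closed s → Γ ⊆ x ∷ Δ →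
                    ClosedInG Δ (g [ s / x ]g)
    ClosedInG-[/] (a ∙ cu)  cs h = a ∙ ClosedIn-[/] cu cs h
    ClosedInG-[/] (gcon k)  cs h = gcon k
    ClosedInG-[/] (cg ⊞ ch) cs h = ClosedInG-[/] cg cs h ⊞ ClosedInG-[/] ch cs h

  mutual
    [/]-fresh : ∀ {Γ u s x} → ClosedIn Γ u → x ∉ Γ → u [ s / x ] ≡ u
    [/]-fresh (con k) x∉Γ = ≡.refl
    [/]-fresh {x = x} (var {y} i) x∉Γ with x ℕ.≟ y
    ... | yes ≡.refl = ⊥-elim (x∉Γ i)
    ... | no _       = ≡.refl
    [/]-fresh (sym a)   x∉Γ = ≡.refl
    [/]-fresh (cu ⊕ cv) x∉Γ = ≡.cong₂ _⊕_ ([/]-fresh cu x∉Γ) ([/]-fresh cv x∉Γ)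
    [/]-fresh (cu ⊗ cv) x∉Γ = ≡.cong₂ _⊗_ ([/]-fresh cu x∉Γ) ([/]-fresh cv x∉Γ)
    [/]-fresh {x = x} (μ {y} cg) x∉Γ with x ℕ.≟ y
    ... | yes _   = ≡.refl
    ... | no x≢y  = ≡.cong (μ y) ([/]G-fresh cg λ { (here x≡y) → x≢y x≡y ; (there i) → x∉Γ i })

    [/]G-fresh : ∀ {Γ g s x} → ClosedInG Γ g → x ∉ Γ → g [ s / x ]g ≡ g
    [/]G-fresh (a ∙ cu)  x∉Γ = ≡.cong (a ∙_) ([/]-fresh cu x∉Γ)
    [/]G-fresh (gcon k)  x∉Γ = ≡.refl
    [/]G-fresh (cg ⊞ ch) x∉Γ = ≡.cong₂ _⊞_ ([/]G-fresh cg x∉Γ) ([/]G-fresh ch x∉Γ)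

  mutual
    μ-count : Term → ℕ
    μ-count (con k) = 0
    μ-count (var x) = 0
    μ-count (sym a) = 0
    μ-count (u ⊕ v) = μ-count u ℕ.+ μ-count v
    μ-count (u ⊗ v) = μ-count u ℕ.+ μ-count v
    μ-count (μ x g) = ℕ.suc (μ-countG g)

    μ-countG : Guarded → ℕ
    μ-countG (a ∙ u)  = μ-count u
    μ-countG (gcon k) = 0
    μ-countG (g ⊞ h)  = μ-countG g ℕ.+ μ-countG h

module Construction {c ℓ} (K : CommutativeSemiring c ℓ) (m : ℕ) (t : Semantics.Term K m) where
  open CommutativeSemiring K using (0#; 1#; refl)
  open Semantics K m hiding (Series; _≈ₛ_)
  open FormalSeries K A
  open MuExpressions K m
  open Solutions K m
  open SetoidReasoning seriesSetoid

  -- one variable for each letter, then one for each μ-occurrence of t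
  N : ℕ
  N = m ℕ.+ μ-count t

  open Polynomials K (Fin N)

  -- An entry (x , s , i) substitutes the closed term s for x, and the
  -- variable i stands for s.
  Env : Set c
  Env = List (Var × Term × Fin N)

  dom : Env → List Var
  dom = map proj₁

  sub* : Env → Term → Term
  sub* []                u = u
  sub* ((x , s , _) ∷ ρ) u = sub* ρ (u [ s / x ])

  subG* : Env → Guarded → Guarded
  subG* []                g = g
  subG* ((x , s , _) ∷ ρ) g = subG* ρ (g [ s / x ]g)

  remove : Var → Env → Env
  remove y [] = []
  remove y ((x , s , i) ∷ ρ) with x ℕ.≟ y
  ... | yes _ = remove y ρ
  ... | no  _ = (x , s , i) ∷ remove y ρ

  lookupVar : Env → Var → Polynomial
  lookupVar []                x = []
  lookupVar ((y , _ , i) ∷ ρ) x with y ℕ.≟ x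
  ... | yes _ = (1# , i ∷ []) ∷ []
  ... | no  _ = lookupVar ρ x

  letterVar : A → Fin N
  letterVar b = b ↑ˡ μ-count t

  translate : Env → (u : Term) → (Fin (μ-count u) → Fin N) → Polynomial
  translate ρ (con k) e = (k , []) ∷ []
  translate ρ (var x) e = lookupVar ρ x
  translate ρ (sym b) e = (1# , letterVar b ∷ []) ∷ []
  translate ρ (u ⊕ v) e =
    translate ρ u (e ∘ (_↑ˡ μ-count v)) ++ translate ρ v (e ∘ (μ-count u ↑ʳ_))
  translate ρ (u ⊗ v) e =
    translate ρ u (e ∘ (_↑ˡ μ-count v)) *ₚ translate ρ v (e ∘ (μ-count u ↑ʳ_))
  translate ρ (μ y g) e = (1# , e zero ∷ []) ∷ []

  derivG : Env → (g : Guarded) → (Fin (μ-countG g) → Fin N) → A → Polynomial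
  derivG ρ (b ∙ u)  e a = kronecker b a ·ˢ translate ρ u e
  derivG ρ (gcon k) e a = []
  derivG ρ (g ⊞ h)  e a =
    derivG ρ g (e ∘ (_↑ˡ μ-countG h)) a ++ derivG ρ h (e ∘ (μ-countG g ↑ʳ_)) a

  -- Inside μ y g the binder shadows any entry for y, and y itself is substituted last.
  bodyEnv : Env → Var → (g : Guarded) → (Fin (ℕ.suc (μ-countG g)) → Fin N) → Env
  bodyEnv ρ y g e = remove y ρ ++ (y , sub* ρ (μ y g) , e zero) ∷ []

  -- a closed term and the polynomials for its derivatives
  Node : Set c
  Node = Term × (A → Polynomial)

  mutual
    nodes : Env → (u : Term) → (Fin (μ-count u) → Fin N) → Fin (μ-count u) → Node
    nodes ρ (u ⊕ v) e p =
      [ nodes ρ u (e ∘ (_↑ˡ μ-count v)) , nodes ρ v (e ∘ (μ-count u ↑ʳ_)) ]′ (splitAt (μ-count u) p)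
    nodes ρ (u ⊗ v) e p =
      [ nodes ρ u (e ∘ (_↑ˡ μ-count v)) , nodes ρ v (e ∘ (μ-count u ↑ʳ_)) ]′ (splitAt (μ-count u) p)
    nodes ρ (μ y g) e zero    = sub* ρ (μ y g) , derivG (bodyEnv ρ y g e) g (e ∘ suc)
    nodes ρ (μ y g) e (suc q) = nodesG (bodyEnv ρ y g e) g (e ∘ suc) q

    nodesG : Env → (g : Guarded) → (Fin (μ-countG g) → Fin N) → Fin (μ-countG g) → Node
    nodesG ρ (b ∙ u) e p = nodes ρ u e p
    nodesG ρ (g ⊞ h) e p =
      [ nodesG ρ g (e ∘ (_↑ˡ μ-countG h)) , nodesG ρ h (e ∘ (μ-countG g ↑ʳ_)) ]′ (splitAt (μ-countG g) p)

  letterNode : A → Node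
  letterNode b = sym b , λ a → (kronecker b a , []) ∷ []

  table : Fin N → Node
  table i = [ letterNode , nodes [] t (m ↑ʳ_) ]′ (splitAt m i)

  system : System N
  system = record { out = o ∘ proj₁ ∘ table ; der = proj₂ ∘ table }

  solution : Fin N → Series
  solution = ⟦_⟧ ∘ proj₁ ∘ table

  open Evaluation K solution

  Represents : Var × Term × Fin N → Set (c ⊔ ℓ)
  Represents (_ , s , i) = Closed s × solution i ≈ₛ ⟦ s ⟧

  WellFormed : Env → Set (c ⊔ ℓ)
  WellFormed = All Represents

  -- ties the knot: e assigns to the μ-occurrences of a subterm exactly the
  -- variables under which table lists them
  Tabulates : ∀ {k} → (Fin k → Fin N) → (Fin k → Node) → Set c
  Tabulates e f = ∀ p → table (e p) ≡ f p

  DerivativeCorrect : Node → Set ℓ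
  DerivativeCorrect (s , d) = ∀ a → ∂ a ⟦ s ⟧ ≈ₛ eval (d a)

  sub*-con : ∀ ρ k → sub* ρ (con k) ≡ con k
  sub*-con []                k = ≡.refl
  sub*-con ((x , s , i) ∷ ρ) k = sub*-con ρ k

  sub*-sym : ∀ ρ b → sub* ρ (sym b) ≡ sym b
  sub*-sym []                b = ≡.refl
  sub*-sym ((x , s , i) ∷ ρ) b = sub*-sym ρ b

  sub*-⊕ : ∀ ρ u v → sub* ρ (u ⊕ v) ≡ sub* ρ u ⊕ sub* ρ v
  sub*-⊕ []                u v = ≡.refl
  sub*-⊕ ((x , s , i) ∷ ρ) u v = sub*-⊕ ρ _ _

  sub*-⊗ : ∀ ρ u v → sub* ρ (u ⊗ v) ≡ sub* ρ u ⊗ sub* ρ v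
  sub*-⊗ []                u v = ≡.refl
  sub*-⊗ ((x , s , i) ∷ ρ) u v = sub*-⊗ ρ _ _

  sub*-μ : ∀ ρ y g → sub* ρ (μ y g) ≡ μ y (subG* (remove y ρ) g)
  sub*-μ []                y g = ≡.refl
  sub*-μ ((x , s , i) ∷ ρ) y g with x ℕ.≟ y
  ... | yes _ = sub*-μ ρ y g
  ... | no  _ = sub*-μ ρ y (g [ s / x ]g)

  sub*-++ : ∀ ρ ρ′ u → sub* (ρ ++ ρ′) u ≡ sub* ρ′ (sub* ρ u)
  sub*-++ []                ρ′ u = ≡.refl
  sub*-++ ((x , s , i) ∷ ρ) ρ′ u = sub*-++ ρ ρ′ _

  subG*-∙ : ∀ ρ b u → subG* ρ (b ∙ u) ≡ b ∙ sub* ρ u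
  subG*-∙ []                b u = ≡.refl
  subG*-∙ ((x , s , i) ∷ ρ) b u = subG*-∙ ρ b _

  subG*-gcon : ∀ ρ k → subG* ρ (gcon k) ≡ gcon k
  subG*-gcon []                k = ≡.refl
  subG*-gcon ((x , s , i) ∷ ρ) k = subG*-gcon ρ k

  subG*-⊞ : ∀ ρ g h → subG* ρ (g ⊞ h) ≡ subG* ρ g ⊞ subG* ρ h
  subG*-⊞ []                g h = ≡.refl
  subG*-⊞ ((x , s , i) ∷ ρ) g h = subG*-⊞ ρ _ _

  sub*-closed : ∀ ρ {s} → Closed s → sub* ρ s ≡ s
  sub*-closed []                cs = ≡.refl
  sub*-closed ((x , s , i) ∷ ρ) cs = ≡.trans (≡.cong (sub* ρ) ([/]-fresh cs λ ())) (sub*-closed ρ cs)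

  ClosedIn-sub* : ∀ {ρ u} → WellFormed ρ → ClosedIn (dom ρ) u → Closed (sub* ρ u)
  ClosedIn-sub* []               cu = cu
  ClosedIn-sub* ((cs , _) ∷ wf) cu = ClosedIn-sub* wf (ClosedIn-[/] cu cs (λ z∈ → z∈))

  remove-wellFormed : ∀ y {ρ} → WellFormed ρ → WellFormed (remove y ρ)
  remove-wellFormed y [] = []
  remove-wellFormed y {(x , s , i) ∷ ρ} (r ∷ wf) with x ℕ.≟ y
  ... | yes _ = remove-wellFormed y wf
  ... | no  _ = r ∷ remove-wellFormed y wf

  dom-remove : ∀ y ρ {z} → z ∈ dom ρ → z ≡ y ⊎ z ∈ dom (remove y ρ)
  dom-remove y ((x , s , i) ∷ ρ) z∈ with x ℕ.≟ y | z∈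
  ... | yes x≡y | here z≡x = inj₁ (≡.trans z≡x x≡y)
  ... | yes _   | there z∈ρ = dom-remove y ρ z∈ρ
  ... | no  _   | here z≡x = inj₂ (here z≡x)
  ... | no  _   | there z∈ρ = Sum.map₂ there (dom-remove y ρ z∈ρ)

  dom-bodyEnv : ∀ ρ y g e → y ∷ dom ρ ⊆ dom (bodyEnv ρ y g e)
  dom-bodyEnv ρ y g e {z} z∈
    rewrite map-++ proj₁ (remove y ρ) ((y , sub* ρ (μ y g) , e zero) ∷ []) with z∈
  ... | here z≡y  = xs⊆ys++xs (y ∷ []) (dom (remove y ρ)) (here z≡y)
  ... | there z∈ρ with dom-remove y ρ z∈ρ
  ...   | inj₁ z≡y  = xs⊆ys++xs (y ∷ []) (dom (remove y ρ)) (here z≡y)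
  ...   | inj₂ z∈ρ′ = xs⊆xs++ys (dom (remove y ρ)) (y ∷ []) z∈ρ′

  tabulates-↑ˡ : ∀ i {j} {e : Fin (i ℕ.+ j) → Fin N} {f : Fin i → Node} {g : Fin j → Node} →
                 Tabulates e ([ f , g ]′ ∘ splitAt i) → Tabulates (e ∘ (_↑ˡ j)) f
  tabulates-↑ˡ i {j} {f = f} {g} tab q =
    ≡.trans (tab (q ↑ˡ j)) (≡.cong [ f , g ]′ (splitAt-↑ˡ i q j))

  tabulates-↑ʳ : ∀ i {j} {e : Fin (i ℕ.+ j) → Fin N} {f : Fin i → Node} {g : Fin j → Node} →
                 Tabulates e ([ f , g ]′ ∘ splitAt i) → Tabulates (e ∘ (i ↑ʳ_)) g
  tabulates-↑ʳ i {j} {f = f} {g} tab q =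
    ≡.trans (tab (i ↑ʳ q)) (≡.cong [ f , g ]′ (splitAt-↑ʳ i j q))

  tabulates-t : Tabulates (m ↑ʳ_) (nodes [] t (m ↑ʳ_))
  tabulates-t = tabulates-↑ʳ m {f = letterNode} (λ _ → ≡.refl)

  table-letterVar : ∀ b → table (letterVar b) ≡ letterNode b
  table-letterVar = tabulates-↑ˡ m {g = nodes [] t (m ↑ʳ_)} (λ _ → ≡.refl)

  ⟦sub*-var⟧ : ∀ {ρ} → WellFormed ρ → ∀ x → ⟦ sub* ρ (var x) ⟧ ≈ₛ eval (lookupVar ρ x)
  ⟦sub*-var⟧ [] x = ⟦var⟧ x
  ⟦sub*-var⟧ {(y , s , i) ∷ ρ} ((cs , i≈s) ∷ wf) x with y ℕ.≟ x
  ... | yes _ = begin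
    ⟦ sub* ρ s ⟧                   ≡⟨ ≡.cong ⟦_⟧ (sub*-closed ρ cs) ⟩
    ⟦ s ⟧                          ≈⟨ i≈s ⟨
    solution i                     ≈⟨ eval-variable i ⟨
    eval ((1# , i ∷ []) ∷ [])      ∎
  ... | no  _ = ⟦sub*-var⟧ wf x

  ⟦sub*⟧≈eval-translate : ∀ {ρ} → WellFormed ρ → ∀ u e → Tabulates e (nodes ρ u e) →
                          ⟦ sub* ρ u ⟧ ≈ₛ eval (translate ρ u e)
  ⟦sub*⟧≈eval-translate {ρ} wf (con k) e tab = begin
    ⟦ sub* ρ (con k) ⟧     ≡⟨ ≡.cong ⟦_⟧ (sub*-con ρ k) ⟩
    ⟦ con k ⟧              ≈⟨ ⟦con⟧ k ⟩
    k • 1ₛ                 ≈⟨ eval-constant k ⟨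
    eval ((k , []) ∷ [])   ∎
  ⟦sub*⟧≈eval-translate wf (var x) e tab = ⟦sub*-var⟧ wf x
  ⟦sub*⟧≈eval-translate {ρ} wf (sym b) e tab = begin
    ⟦ sub* ρ (sym b) ⟧     ≡⟨ ≡.cong ⟦_⟧ (sub*-sym ρ b) ⟩
    ⟦ sym b ⟧              ≡⟨ ≡.cong (⟦_⟧ ∘ proj₁) (table-letterVar b) ⟨
    solution (letterVar b) ≈⟨ eval-variable (letterVar b) ⟨
    eval ((1# , letterVar b ∷ []) ∷ []) ∎
  ⟦sub*⟧≈eval-translate {ρ} wf (u ⊕ v) e tab = begin
    ⟦ sub* ρ (u ⊕ v) ⟧               ≡⟨ ≡.cong ⟦_⟧ (sub*-⊕ ρ u v) ⟩
    ⟦ sub* ρ u ⊕ sub* ρ v ⟧          ≈⟨ ⟦⊕⟧ (sub* ρ u) (sub* ρ v) ⟩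
    ⟦ sub* ρ u ⟧ +ₛ ⟦ sub* ρ v ⟧     ≈⟨ +ₛ-cong (⟦sub*⟧≈eval-translate wf u _ (tabulates-↑ˡ (μ-count u) tab))
                                                (⟦sub*⟧≈eval-translate wf v _ (tabulates-↑ʳ (μ-count u) tab)) ⟩
    eval pu +ₛ eval pv               ≈⟨ eval-++ pu pv ⟨
    eval (pu ++ pv)                  ∎
    where pu = translate ρ u (e ∘ (_↑ˡ μ-count v))
          pv = translate ρ v (e ∘ (μ-count u ↑ʳ_))
  ⟦sub*⟧≈eval-translate {ρ} wf (u ⊗ v) e tab = begin
    ⟦ sub* ρ (u ⊗ v) ⟧               ≡⟨ ≡.cong ⟦_⟧ (sub*-⊗ ρ u v) ⟩
    ⟦ sub* ρ u ⊗ sub* ρ v ⟧          ≈⟨ ⟦⊗⟧ (sub* ρ u) (sub* ρ v) ⟩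
    ⟦ sub* ρ u ⟧ *ₛ ⟦ sub* ρ v ⟧     ≈⟨ *ₛ-cong (⟦sub*⟧≈eval-translate wf u _ (tabulates-↑ˡ (μ-count u) tab))
                                                (⟦sub*⟧≈eval-translate wf v _ (tabulates-↑ʳ (μ-count u) tab)) ⟩
    eval pu *ₛ eval pv               ≈⟨ eval-*ₚ pu pv ⟨
    eval (pu *ₚ pv)                  ∎
    where pu = translate ρ u (e ∘ (_↑ˡ μ-count v))
          pv = translate ρ v (e ∘ (μ-count u ↑ʳ_))
  ⟦sub*⟧≈eval-translate {ρ} wf (μ y g) e tab = begin
    ⟦ sub* ρ (μ y g) ⟧               ≡⟨ ≡.cong (⟦_⟧ ∘ proj₁) (tab zero) ⟨
    solution (e zero)                ≈⟨ eval-variable (e zero) ⟨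
    eval ((1# , e zero ∷ []) ∷ [])   ∎

  ⟦δG⟧≈eval-derivG : ∀ ρ y s i a → WellFormed (ρ ++ (y , s , i) ∷ []) → ∀ g e →
                     Tabulates e (nodesG (ρ ++ (y , s , i) ∷ []) g e) →
                     ⟦ δG (subG* ρ g) s y a ⟧ ≈ₛ eval (derivG (ρ ++ (y , s , i) ∷ []) g e a)
  ⟦δG⟧≈eval-derivG ρ y s i a wf (b ∙ u) e tab = begin
    ⟦ δG (subG* ρ (b ∙ u)) s y a ⟧               ≡⟨ ≡.cong (λ g → ⟦ δG g s y a ⟧) (subG*-∙ ρ b u) ⟩
    ⟦ δsym b a ⊗ (sub* ρ u [ s / y ]) ⟧          ≡⟨ ≡.cong (λ d → ⟦ d ⊗ _ ⟧) (δsym≡con-kronecker b a) ⟩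
    ⟦ con (kronecker b a) ⊗ (sub* ρ u [ s / y ]) ⟧ ≈⟨ ⟦con⊗⟧ (kronecker b a) _ ⟩
    kronecker b a • ⟦ sub* ρ u [ s / y ] ⟧       ≡⟨ ≡.cong (λ v → kronecker b a • ⟦ v ⟧) (sub*-++ ρ _ u) ⟨
    kronecker b a • ⟦ sub* ρ′ u ⟧                ≈⟨ •-congˡ (⟦sub*⟧≈eval-translate wf u e tab) ⟩
    kronecker b a • eval (translate ρ′ u e)      ≈⟨ eval-·ˢ (kronecker b a) (translate ρ′ u e) ⟨
    eval (kronecker b a ·ˢ translate ρ′ u e)     ∎
    where ρ′ = ρ ++ (y , s , i) ∷ []
  ⟦δG⟧≈eval-derivG ρ y s i a wf (gcon k) e tab = begin
    ⟦ δG (subG* ρ (gcon k)) s y a ⟧   ≡⟨ ≡.cong (λ g → ⟦ δG g s y a ⟧) (subG*-gcon ρ k) ⟩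
    ⟦ con 0# ⟧                       ≈⟨ ⟦0⟧ ⟩
    0ₛ                               ∎
  ⟦δG⟧≈eval-derivG ρ y s i a wf (g ⊞ h) e tab = begin
    ⟦ δG (subG* ρ (g ⊞ h)) s y a ⟧    ≡⟨ ≡.cong (λ g → ⟦ δG g s y a ⟧) (subG*-⊞ ρ g h) ⟩
    ⟦ δG (subG* ρ g) s y a ⊕ δG (subG* ρ h) s y a ⟧
      ≈⟨ ⟦⊕⟧ (δG (subG* ρ g) s y a) (δG (subG* ρ h) s y a) ⟩
    ⟦ δG (subG* ρ g) s y a ⟧ +ₛ ⟦ δG (subG* ρ h) s y a ⟧
      ≈⟨ +ₛ-cong (⟦δG⟧≈eval-derivG ρ y s i a wf g _ (tabulates-↑ˡ (μ-countG g) tab))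
                 (⟦δG⟧≈eval-derivG ρ y s i a wf h _ (tabulates-↑ʳ (μ-countG g) tab)) ⟩
    eval dg +ₛ eval dh               ≈⟨ eval-++ dg dh ⟨
    eval (dg ++ dh)                  ∎
    where dg = derivG (ρ ++ (y , s , i) ∷ []) g (e ∘ (_↑ˡ μ-countG h)) a
          dh = derivG (ρ ++ (y , s , i) ∷ []) h (e ∘ (μ-countG g ↑ʳ_)) a

  [,]-correct : ∀ {i j} {f : Fin i → Node} {g : Fin j → Node} →
                (∀ q → DerivativeCorrect (f q)) → (∀ q → DerivativeCorrect (g q)) →
                ∀ x → DerivativeCorrect ([ f , g ]′ x)
  [,]-correct hf hg = [ hf , hg ]

  δ-sub*-μ : ∀ ρ y g a → δ (sub* ρ (μ y g)) a ≡ δG (subG* (remove y ρ) g) (sub* ρ (μ y g)) y a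
  δ-sub*-μ ρ y g a rewrite sub*-μ ρ y g = ≡.refl

  bodyEnv-wellFormed : ∀ {ρ} y g e → WellFormed ρ → ClosedIn (dom ρ) (μ y g) →
                       Tabulates e (nodes ρ (μ y g) e) → WellFormed (bodyEnv ρ y g e)
  bodyEnv-wellFormed y g e wf cu tab =
    All.++⁺ (remove-wellFormed y wf)
            ((ClosedIn-sub* wf cu , ≈ₛ-reflexive (≡.cong (⟦_⟧ ∘ proj₁) (tab zero))) ∷ [])

  mutual
    nodes-correct : ∀ {ρ} → WellFormed ρ → ∀ u e → ClosedIn (dom ρ) u →
                    Tabulates e (nodes ρ u e) → ∀ p → DerivativeCorrect (nodes ρ u e p)
    nodes-correct wf (u ⊕ v) e (cu ⊕ cv) tab p =
      [,]-correct (nodes-correct wf u _ cu (tabulates-↑ˡ (μ-count u) tab))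
                  (nodes-correct wf v _ cv (tabulates-↑ʳ (μ-count u) tab)) (splitAt (μ-count u) p)
    nodes-correct wf (u ⊗ v) e (cu ⊗ cv) tab p =
      [,]-correct (nodes-correct wf u _ cu (tabulates-↑ˡ (μ-count u) tab))
                  (nodes-correct wf v _ cv (tabulates-↑ʳ (μ-count u) tab)) (splitAt (μ-count u) p)
    nodes-correct {ρ} wf (μ y g) e cu tab zero a = begin
      ⟦ δ (sub* ρ (μ y g)) a ⟧                           ≡⟨ ≡.cong ⟦_⟧ (δ-sub*-μ ρ y g a) ⟩
      ⟦ δG (subG* (remove y ρ) g) (sub* ρ (μ y g)) y a ⟧
        ≈⟨ ⟦δG⟧≈eval-derivG (remove y ρ) y _ (e zero) a (bodyEnv-wellFormed y g e wf cu tab)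
                            g (e ∘ suc) (tab ∘ suc) ⟩
      eval (derivG (bodyEnv ρ y g e) g (e ∘ suc) a)      ∎
    nodes-correct {ρ} wf (μ y g) e cu@(μ cg) tab (suc q) =
      nodesG-correct (bodyEnv-wellFormed y g e wf cu tab) g (e ∘ suc)
                     (ClosedInG-mono (dom-bodyEnv ρ y g e) cg) (tab ∘ suc) q

    nodesG-correct : ∀ {ρ} → WellFormed ρ → ∀ g e → ClosedInG (dom ρ) g →
                     Tabulates e (nodesG ρ g e) → ∀ p → DerivativeCorrect (nodesG ρ g e p)
    nodesG-correct wf (b ∙ u) e (_ ∙ cu) tab p = nodes-correct wf u e cu tab p
    nodesG-correct wf (g ⊞ h) e (cg ⊞ ch) tab p =
      [,]-correct (nodesG-correct wf g _ cg (tabulates-↑ˡ (μ-countG g) tab))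
                  (nodesG-correct wf h _ ch (tabulates-↑ʳ (μ-countG g) tab)) (splitAt (μ-countG g) p)

  letterNode-correct : ∀ b → DerivativeCorrect (letterNode b)
  letterNode-correct b a = begin
    ⟦ δsym b a ⟧                  ≡⟨ ≡.cong ⟦_⟧ (δsym≡con-kronecker b a) ⟩
    ⟦ con (kronecker b a) ⟧       ≈⟨ ⟦con⟧ (kronecker b a) ⟩
    kronecker b a • 1ₛ            ≈⟨ eval-constant (kronecker b a) ⟨
    eval ((kronecker b a , []) ∷ []) ∎

  solution-isSolution : Closed t → IsSolution system solution
  solution-isSolution closed = record
    { output     = λ _ → refl
    ; derivative = λ i → [,]-correct letterNode-correct
                           (nodes-correct [] t (m ↑ʳ_) closed tabulates-t) (splitAt m i)
    }

  ⟦⟧-contextFree : Closed t → ContextFree ⟦ t ⟧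
  ⟦⟧-contextFree closed = N , system , p , ⟦p⟧ₚ≈⟦t⟧
    where
      p = translate [] t (m ↑ʳ_)
      ⟦p⟧ₚ≈⟦t⟧ : Extension.⟦_⟧ₚ system p ≈ₛ ⟦ t ⟧
      ⟦p⟧ₚ≈⟦t⟧ = begin
        Extension.⟦_⟧ₚ system p ≈⟨ ⟦⟧ₚ≈eval (solution-isSolution closed) p ⟩
        eval p                 ≈⟨ ⟦sub*⟧≈eval-translate [] t (m ↑ʳ_) tabulates-t ⟨
        ⟦ t ⟧                  ∎

theorem6p12 : ∀ {c ℓ} (K : CommutativeSemiring c ℓ) (m : ℕ)
    (t : Semantics.Term K m) → Semantics.Closed K m t →
    Semantics.ContextFree K m (Semantics.⟦_⟧ K m t)
theorem6p12 K m t = Construction.⟦⟧-contextFree K m t
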